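{- Let $v>71$ and let $(X,\mathcal{B})$ be a Steiner triple system of order $v$ with point set $X=\{1,\dots,v\}$. Then there is a sequencing $\pi=[x_1\,x_2\,\cdots\,x_v]$ of $X$ that is $4$-good for $(X,\mathcal{B})$, i.e. for every $1\le i\le v-3$, no block of $\mathcal{B}$ is contained in $\{x_i,x_{i+1},x_{i+2},x_{i+3}\}$.
   Context: A Steiner triple system of order $v$ is a pair $(X,\mathcal{B})$ where $X$ is a set of $v$ points and $\mathcal{B}$ is a set of 3-subsets of $X$ (blocks) such that every pair of distinct points lies in exactly one block. A sequencing of $X$ is an ordering of all points of $X$, each appearing exactly once. A sequencing is $4$-good if no four consecutive points in it contain a block. -}

module Defs where

open import Data.Nat using (ℕ; _+_; _<_)
open import Data.Fin using (Fin; fromℕ<)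
open import Data.Fin.Subset using (Subset; _∈_; _⊆_; ∣_∣)
open import Data.Fin.Permutation using (Permutation′; _⟨$⟩ʳ_)
open import Data.Product using (Σ; _×_; ∃)
open import Data.Sum using (_⊎_)
open import Relation.Binary.PropositionalEquality using (_≡_; _≢_)
open import Relation.Nullary using (¬_)
open import Level using (0ℓ; suc)

-- A Steiner triple system of order v on the point set Fin v (i.e. {1,…,v}
-- relabelled as {0,…,v-1}).  The block set 𝓑 is a set of subsets of the
-- point set, given as a predicate on Subset v.
record STS (v : ℕ) : Set₁ where
  field
    Block     : Subset v → Set
    block-size : ∀ b → Block b → ∣ b ∣ ≡ 3
    pair-covered : ∀ x y → x ≢ y → Σ (Subset v) λ b → Block b × x ∈ b × y ∈ b
    pair-unique : ∀ x y → x ≢ y → ∀ b b′ → Block b → Block b′ →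
                  x ∈ b → y ∈ b → x ∈ b′ → y ∈ b′ → b ≡ b′

-- A sequencing of the points: an ordering [x₀ x₁ … x_{v-1}] in which every
-- point appears exactly once, i.e. a permutation of Fin v; x_i = π ⟨$⟩ʳ i.
Sequencing : ℕ → Set
Sequencing v = Permutation′ v

ContainedIn4 : ∀ {v} → Subset v → Fin v → Fin v → Fin v → Fin v → Set
ContainedIn4 b p q r s = ∀ x → x ∈ b → (x ≡ p ⊎ x ≡ q ⊎ x ≡ r ⊎ x ≡ s)

-- 4-good: no four consecutive points of the sequencing contain a block.
-- Position i ranges over 0 ≤ i, i+3 < v (paper's 1 ≤ i ≤ v-3).
FourGood : ∀ {v} → STS v → Sequencing v → Set
FourGood {v} S π =
  ∀ (i : ℕ) (h : i + 3 < v) → ∀ b → STS.Block S b →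
    ¬ ContainedIn4 b
        (π ⟨$⟩ʳ fromℕ< {i} (lemma0 h))
        (π ⟨$⟩ʳ fromℕ< {i + 1} (lemma1 h))
        (π ⟨$⟩ʳ fromℕ< {i + 2} (lemma2 h))
        (π ⟨$⟩ʳ fromℕ< {i + 3} h)
  where
  open import Data.Nat.Properties using (≤-<-trans; +-monoʳ-≤; m≤m+n)
  open import Data.Nat using (_≤_; s≤s; z≤n)
  lemma0 : ∀ {i} → i + 3 < v → i < v
  lemma0 {i} h = ≤-<-trans (m≤m+n i 3) h
  lemma1 : ∀ {i} → i + 3 < v → i + 1 < v
  lemma1 {i} h = ≤-<-trans (+-monoʳ-≤ i (s≤s z≤n)) h
  lemma2 : ∀ {i} → i + 3 < v → i + 2 < v
  lemma2 {i} h = ≤-<-trans (+-monoʳ-≤ i (s≤s (s≤s z≤n))) h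

module Submission where

-- A point e can be put in front of a 4-good list without creating a block among the first
-- four points unless e is the third point x · y of the block through two of the current first
-- three points: at most three values are forbidden, so greedy placement works while at least
-- four candidates remain.  To finish, reserve an independent set P₀ of 12 points (no x · y with
-- x, y ∈ P₀ lies in P₀), chosen greedily: the k-th point avoids k - 1 + (k - 1 choose 2) ≤ 66 < v
-- points.  Place the other points greedily until three remain; place each of those right after
-- two points of P₀ chosen so that it is allowed; then place three more points of P₀ greedily,
-- after which every remaining point of P₀ is allowed by independence.

open import Defs
open import Axiom.UniquenessOfIdentityProofs using (module Decidable⇒UIP)
open import Data.Empty using (⊥; ⊥-elim)
open import Data.Fin using (Fin; zero; suc; fromℕ<; cast)
open import Data.Fin.Permutation using (Permutation; permutation; cast-id; _∘ₚ_; ↔⇒≡)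
open import Data.Fin.Properties using (_≟_; any?)
open import Data.Fin.Subset
  using (Subset; _∈_; _∉_; ∣_∣; _∪_; _─_; _-_; ⁅_⁆; ∁; Empty; inside; outside)
  renaming (⊤ to ⊤ˢ; ⊥ to ⊥ˢ)
open import Data.Fin.Subset.Properties
  using ( _∈?_; nonempty?; ∉⊥; x∈⁅x⁆; x∈⁅y⁆⇒x≡y; ∣⁅x⁆∣≡1; ∣⊥∣≡0; ∣⊤∣≡n; ∣p∣≤n
        ; p⊆q⇒∣p∣≤∣q∣; x∈p∪q⁺; x∈p∪q⁻; p─q⊆p; ∣p─q∣≤∣p∣; x∈p∧x≢y⇒x∈p-y; x∈p⇒∣p-x∣<∣p∣
        ; x∈∁p⇒x∉p; x∉p⇒x∈∁p )
open import Data.List using (List; []; _∷_; length; map; _++_; take; lookup)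
open import Data.List.Membership.Propositional using () renaming (_∈_ to _∈ᴸ_; _∉_ to _∉ᴸ_)
open import Data.List.Membership.Propositional.Properties
  using (∈-++⁺ˡ; ∈-++⁺ʳ; ∈-++⁻; ∈-map⁺; ∈-map⁻; ∈-lookup)
import Data.List.Membership.Setoid.Properties as SetoidMembership
open import Data.List.Properties using (length-++; length-map)
open import Data.List.Relation.Binary.Disjoint.Propositional using (Disjoint)
open import Data.List.Relation.Binary.Subset.Propositional using () renaming (_⊆_ to _⊆ᴸ_)
open import Data.List.Relation.Unary.All as All using (_∷_; [])
open import Data.List.Relation.Unary.All.Properties using (¬Any⇒All¬)
open import Data.List.Relation.Unary.AllPairs using ([]; _∷_)
open import Data.List.Relation.Unary.Any using (here; there; index) renaming (any? to anyᴸ?)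
open import Data.List.Relation.Unary.Any.Properties using (lookup-index)
open import Data.List.Relation.Unary.Unique.Propositional using (Unique)
import Data.List.Relation.Unary.Unique.Propositional.Properties as Unique
open import Data.Nat using (ℕ; zero; suc; _+_; _*_; _≤_; _<_; _>_; _≤?_; z≤n; s≤s)
open import Data.Nat.Combinatorics using (_C_; nC1≡n; nCk+nC[k+1]≡[n+1]C[k+1])
open import Data.Nat.Properties
  using ( ≤-refl; ≤-reflexive; ≤-trans; ≤-<-trans; <-≤-trans; ≤-pred; n≤1+n; m≤n⇒m≤1+n
        ; m≤m+n; m≤n+m; +-suc; *-suc; +-monoʳ-≤; +-monoˡ-≤; +-mono-≤; <⇒≱; ≰⇒>; n≮0
        ; module ≤-Reasoning )
open import Data.Product using (Σ; _×_; _,_; proj₁; proj₂; ∃; ∃₂)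
open import Data.Sum as Sum using (_⊎_; inj₁; inj₂; [_,_])
open import Data.Unit using (⊤; tt)
open import Data.Vec using (_∷_; []; here; there)
open import Function using (_∘_; case_of_)
open import Relation.Binary.PropositionalEquality
  using (_≡_; _≢_; refl; sym; trans; cong; subst; ≢-sym; setoid; module ≡-Reasoning)
open import Relation.Nullary using (¬_; yes; no; contradiction; ¬?)
open import Relation.Nullary.Decidable using (_×-dec_; decidable-stable)

private
  variable
    n : ℕ

∈-∷⁻ : ∀ {a} {A : Set a} {x y : A} {ys} → x ∈ᴸ y ∷ ys → x ≢ y → x ∈ᴸ ys
∈-∷⁻ (here x≡y)  x≢y = contradiction x≡y x≢y
∈-∷⁻ (there x∈ys) _  = x∈ys

_⊆ˢᴸ_ : Subset n → List (Fin n) → Set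
p ⊆ˢᴸ xs = ∀ {x} → x ∈ p → x ∈ᴸ xs

x∈p─q⇒x∉q : ∀ {x : Fin n} (p q : Subset n) → x ∈ p ─ q → x ∉ q
x∈p─q⇒x∉q (_ ∷ p) (inside ∷ q) () here
x∈p─q⇒x∉q (_ ∷ p) (_ ∷ q) (there x∈) (there x∈q) = x∈p─q⇒x∉q p q x∈ x∈q

x∈p-y⇒x≢y : ∀ {x y : Fin n} {p : Subset n} → x ∈ p - y → x ≢ y
x∈p-y⇒x≢y {y = y} {p} x∈ refl = x∈p─q⇒x∉q p ⁅ y ⁆ x∈ (x∈⁅x⁆ y)

x∈p-y⇒x∈p : ∀ {x y : Fin n} {p : Subset n} → x ∈ p - y → x ∈ p
x∈p-y⇒x∈p {y = y} {p} = p─q⊆p p ⁅ y ⁆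

∣p∪q∣≤∣p∣+∣q∣ : ∀ (p q : Subset n) → ∣ p ∪ q ∣ ≤ ∣ p ∣ + ∣ q ∣
∣p∪q∣≤∣p∣+∣q∣ [] [] = z≤n
∣p∪q∣≤∣p∣+∣q∣ (inside ∷ p) (inside ∷ q) =
  s≤s (≤-trans (∣p∪q∣≤∣p∣+∣q∣ p q) (+-monoʳ-≤ ∣ p ∣ (n≤1+n ∣ q ∣)))
∣p∪q∣≤∣p∣+∣q∣ (inside ∷ p) (outside ∷ q) = s≤s (∣p∪q∣≤∣p∣+∣q∣ p q)
∣p∪q∣≤∣p∣+∣q∣ (outside ∷ p) (inside ∷ q) =
  ≤-trans (s≤s (∣p∪q∣≤∣p∣+∣q∣ p q)) (≤-reflexive (sym (+-suc ∣ p ∣ ∣ q ∣)))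
∣p∪q∣≤∣p∣+∣q∣ (outside ∷ p) (outside ∷ q) = ∣p∪q∣≤∣p∣+∣q∣ p q

∣p∣≤1+∣p-x∣ : ∀ (p : Subset n) x → ∣ p ∣ ≤ suc ∣ p - x ∣
∣p∣≤1+∣p-x∣ p x = begin
  ∣ p ∣                 ≤⟨ p⊆q⇒∣p∣≤∣q∣ p⊆x∪[p-x] ⟩
  ∣ ⁅ x ⁆ ∪ (p - x) ∣   ≤⟨ ∣p∪q∣≤∣p∣+∣q∣ ⁅ x ⁆ (p - x) ⟩
  ∣ ⁅ x ⁆ ∣ + ∣ p - x ∣ ≡⟨ cong (_+ ∣ p - x ∣) (∣⁅x⁆∣≡1 x) ⟩
  suc ∣ p - x ∣         ∎
  where
  open ≤-Reasoning
  p⊆x∪[p-x] : ∀ {y} → y ∈ p → y ∈ ⁅ x ⁆ ∪ (p - x)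
  p⊆x∪[p-x] {y} y∈p with y ≟ x
  ... | yes refl = x∈p∪q⁺ (inj₁ (x∈⁅x⁆ x))
  ... | no y≢x   = x∈p∪q⁺ (inj₂ (x∈p∧x≢y⇒x∈p-y y∈p y≢x))

x∉p⇒∣p∣≤∣p-x∣ : ∀ {p : Subset n} {x} → x ∉ p → ∣ p ∣ ≤ ∣ p - x ∣
x∉p⇒∣p∣≤∣p-x∣ {p = p} {x = x} x∉p =
  p⊆q⇒∣p∣≤∣q∣ {p = p} {q = p - x} λ y∈p → x∈p∧x≢y⇒x∈p-y y∈p λ { refl → x∉p y∈p }

∣p∣≤0⇒x∉p : ∀ {p : Subset n} {x} → ∣ p ∣ ≤ 0 → x ∉ p
∣p∣≤0⇒x∉p ∣p∣≤0 x∈p = n≮0 (<-≤-trans (x∈p⇒∣p-x∣<∣p∣ x∈p) ∣p∣≤0)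

∣p-x∣≤∣p∣ : ∀ (p : Subset n) x → ∣ p - x ∣ ≤ ∣ p ∣
∣p-x∣≤∣p∣ p x = ∣p─q∣≤∣p∣ p ⁅ x ⁆

∣p∣≤length : ∀ {n} (p : Subset n) xs → p ⊆ˢᴸ xs → ∣ p ∣ ≤ length xs
∣p∣≤length {n} p [] p⊆ =
  ≤-trans (p⊆q⇒∣p∣≤∣q∣ {q = ⊥ˢ} (λ x∈p → contradiction (p⊆ x∈p) λ ())) (≤-reflexive (∣⊥∣≡0 n))
∣p∣≤length p (y ∷ ys) p⊆ = ≤-trans (∣p∣≤1+∣p-x∣ p y) (s≤s (∣p∣≤length (p - y) ys [p-y]⊆ys))
  where
  [p-y]⊆ys : (p - y) ⊆ˢᴸ ys
  [p-y]⊆ys x∈ = ∈-∷⁻ (p⊆ (x∈p-y⇒x∈p x∈)) (x∈p-y⇒x≢y x∈)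

length≤∣p∣ : ∀ (p : Subset n) {xs} → Unique xs → (∀ {x} → x ∈ᴸ xs → x ∈ p) → length xs ≤ ∣ p ∣
length≤∣p∣ p [] _ = z≤n
length≤∣p∣ p {y ∷ ys} (y∉ys ∷ u) xs⊆p =
  ≤-trans (s≤s (length≤∣p∣ (p - y) u ys⊆[p-y])) (x∈p⇒∣p-x∣<∣p∣ (xs⊆p (here refl)))
  where
  ys⊆[p-y] : ∀ {x} → x ∈ᴸ ys → x ∈ p - y
  ys⊆[p-y] x∈ys = x∈p∧x≢y⇒x∈p-y (xs⊆p (there x∈ys)) (λ x≡y → All.lookup y∉ys x∈ys (sym x≡y))

length<∣p∣⇒∃∈p∉ : ∀ (p : Subset n) xs → length xs < ∣ p ∣ → ∃ λ x → x ∈ p × x ∉ᴸ xs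
length<∣p∣⇒∃∈p∉ p xs xs<p with any? (λ x → (x ∈? p) ×-dec ¬? (anyᴸ? (x ≟_) xs))
... | yes witness = witness
... | no none = contradiction (∣p∣≤length p xs p⊆xs) (<⇒≱ xs<p)
  where
  p⊆xs : p ⊆ˢᴸ xs
  p⊆xs {x} x∈p = decidable-stable (anyᴸ? (x ≟_) xs) (λ x∉ → none (x , x∈p , x∉))

fromList : List (Fin n) → Subset n
fromList []       = ⊥ˢ
fromList (x ∷ xs) = ⁅ x ⁆ ∪ fromList xs

∈-fromList⁺ : ∀ {x : Fin n} xs → x ∈ᴸ xs → x ∈ fromList xs
∈-fromList⁺ (y ∷ ys) (here refl) = x∈p∪q⁺ {q = fromList ys} (inj₁ (x∈⁅x⁆ y))
∈-fromList⁺ (y ∷ ys) (there x∈) = x∈p∪q⁺ {p = ⁅ y ⁆} (inj₂ (∈-fromList⁺ ys x∈))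

∈-fromList⁻ : ∀ {x : Fin n} xs → x ∈ fromList xs → x ∈ᴸ xs
∈-fromList⁻ [] x∈ = contradiction x∈ ∉⊥
∈-fromList⁻ (y ∷ ys) x∈ with x∈p∪q⁻ ⁅ y ⁆ (fromList ys) x∈
... | inj₁ x∈y  = here (x∈⁅y⁆⇒x≡y y x∈y)
... | inj₂ x∈ys = there (∈-fromList⁻ ys x∈ys)

∈-four : ∀ {a} {A : Set a} {x p q r s : A} →
         x ≡ p ⊎ x ≡ q ⊎ x ≡ r ⊎ x ≡ s → x ∈ᴸ p ∷ q ∷ r ∷ s ∷ []
∈-four (inj₁ x≡p)               = here x≡p
∈-four (inj₂ (inj₁ x≡q))        = there (here x≡q)
∈-four (inj₂ (inj₂ (inj₁ x≡r))) = there (there (here x≡r))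
∈-four (inj₂ (inj₂ (inj₂ x≡s))) = there (there (there (here x≡s)))

index-∈-lookup : ∀ {a} {A : Set a} (xs : List A) i → index (∈-lookup {xs = xs} i) ≡ i
index-∈-lookup (x ∷ xs) zero    = refl
index-∈-lookup (x ∷ xs) (suc i) = cong suc (index-∈-lookup xs i)

take-⊆ : ∀ {a} {A : Set a} {m n} → m ≤ n → (xs : List A) → take m xs ⊆ᴸ take n xs
take-⊆ (s≤s m≤n) (x ∷ xs) (here x≡) = here x≡
take-⊆ (s≤s m≤n) (x ∷ xs) (there y∈) = there (take-⊆ m≤n xs y∈)

module _ {v : ℕ} (S : STS v) where

  open STS S

  -- The Steiner quasigroup

  block-∃∉ : ∀ {B} xs → Block B → length xs < 3 → ∃ λ x → x ∈ B × x ∉ᴸ xs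
  block-∃∉ {B} xs B-block xs<3 =
    length<∣p∣⇒∃∈p∉ B xs (subst (length xs <_) (sym (block-size B B-block)) xs<3)

  no-four-in-block : ∀ {B x y z w} → Block B → x ∈ B → y ∈ B → z ∈ B → w ∈ B →
                     Unique (x ∷ y ∷ z ∷ w ∷ []) → ⊥
  no-four-in-block {B} B-block x∈ y∈ z∈ w∈ u =
    4≰3 (subst (4 ≤_) (block-size B B-block) (length≤∣p∣ B u λ
      { (here refl) → x∈ ; (there (here refl)) → y∈ ; (there (there (here refl))) → z∈
      ; (there (there (there (here refl)))) → w∈ }))
    where
    4≰3 : ¬ 4 ≤ 3
    4≰3 (s≤s (s≤s (s≤s ())))

  -- x · y is the third point of the block through x and y; the convention x · x = x makes it total.
  _·_ : Fin v → Fin v → Fin v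
  x · y with x ≟ y
  ... | yes _   = x
  ... | no x≢y  = proj₁ (block-∃∉ (x ∷ y ∷ []) (proj₁ (proj₂ (pair-covered x y x≢y))) ≤-refl)

  ·-idem : ∀ x → x · x ≡ x
  ·-idem x with x ≟ x
  ... | yes _   = refl
  ... | no x≢x  = contradiction refl x≢x

  ·-third : ∀ {x y} → x ≢ y →
            (∃ λ B → Block B × x ∈ B × y ∈ B × x · y ∈ B) × x · y ≢ x × x · y ≢ y
  ·-third {x} {y} x≢y with x ≟ y
  ... | yes x≡y = contradiction x≡y x≢y
  ... | no x≢y′ with pair-covered x y x≢y′
  ... | B , B-block , x∈B , y∈B with block-∃∉ (x ∷ y ∷ []) B-block ≤-refl
  ... | z , z∈B , z∉ =
    (B , B-block , x∈B , y∈B , z∈B) , z∉ ∘ here , (λ z≡y → z∉ (there (here z≡y)))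

  ·-unique : ∀ {B x y z} → Block B → x ∈ B → y ∈ B → z ∈ B →
             x ≢ y → z ≢ x → z ≢ y → z ≡ x · y
  ·-unique {B} {x} {y} {z} B-block x∈B y∈B z∈B x≢y z≢x z≢y with ·-third x≢y
  ... | (B′ , B′-block , x∈B′ , y∈B′ , t∈B′) , t≢x , t≢y with z ≟ x · y
  ... | yes z≡t = z≡t
  ... | no  z≢t = ⊥-elim (no-four-in-block B-block x∈B y∈B t∈B z∈B
          ((x≢y ∷ ≢-sym t≢x ∷ ≢-sym z≢x ∷ []) ∷ (≢-sym t≢y ∷ ≢-sym z≢y ∷ []) ∷
           (≢-sym z≢t ∷ []) ∷ [] ∷ []))
    where
    t∈B : x · y ∈ B
    t∈B = subst (x · y ∈_) (pair-unique x y x≢y B′ B B′-block B-block x∈B′ y∈B′ x∈B y∈B) t∈B′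

  ·-comm : ∀ x y → x · y ≡ y · x
  ·-comm x y = case x ≟ y of λ
    { (yes refl) → refl
    ; (no x≢y) → let ((B , B-block , x∈B , y∈B , t∈B) , t≢x , t≢y) = ·-third x≢y
                 in ·-unique B-block y∈B x∈B t∈B (≢-sym x≢y) t≢y t≢x
    }

  x·[x·y]≡y : ∀ x y → x · (x · y) ≡ y
  x·[x·y]≡y x y = case x ≟ y of λ
    { (yes refl) → trans (cong (x ·_) (·-idem x)) (·-idem x)
    ; (no x≢y) → let ((B , B-block , x∈B , y∈B , t∈B) , t≢x , t≢y) = ·-third x≢y
                 in sym (·-unique B-block x∈B t∈B y∈B (≢-sym t≢x) (≢-sym x≢y) (≢-sym t≢y))
    }

  ·-swap : ∀ {x y z} → z ≡ y · x → y ≡ x · z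
  ·-swap {x} {y} refl = sym (trans (cong (x ·_) (·-comm y x)) (x·[x·y]≡y x y))

  thirds : List (Fin v) → List (Fin v)
  thirds []       = []
  thirds (x ∷ xs) = map (x ·_) xs ++ thirds xs

  n+nC2≡[n+1]C2 : ∀ n → n + n C 2 ≡ suc n C 2
  n+nC2≡[n+1]C2 n = trans (cong (_+ n C 2) (sym (nC1≡n n))) (nCk+nC[k+1]≡[n+1]C[k+1] n 1)

  length-thirds : ∀ xs → length (thirds xs) ≡ length xs C 2
  length-thirds []       = refl
  length-thirds (x ∷ xs) = begin
    length (map (x ·_) xs ++ thirds xs)          ≡⟨ length-++ (map (x ·_) xs) ⟩
    length (map (x ·_) xs) + length (thirds xs)  ≡⟨ cong (_+ _) (length-map (x ·_) xs) ⟩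
    length xs + length (thirds xs)               ≡⟨ cong (length xs +_) (length-thirds xs) ⟩
    length xs + length xs C 2                    ≡⟨ n+nC2≡[n+1]C2 (length xs) ⟩
    suc (length xs) C 2                          ∎
    where open ≡-Reasoning

  ·∈thirds : ∀ {x y xs} → x ∈ᴸ xs → y ∈ᴸ xs → x ≢ y → x · y ∈ᴸ thirds xs
  ·∈thirds (here refl) (here refl) x≢y = contradiction refl x≢y
  ·∈thirds {x} (here refl) (there y∈) _ = ∈-++⁺ˡ (∈-map⁺ (x ·_) y∈)
  ·∈thirds {x} {y} (there x∈) (here refl) _ =
    subst (_∈ᴸ _) (·-comm y x) (∈-++⁺ˡ (∈-map⁺ (y ·_) x∈))
  ·∈thirds {xs = a ∷ xs} (there x∈) (there y∈) x≢y =
    ∈-++⁺ʳ (map (a ·_) xs) (·∈thirds x∈ y∈ x≢y)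

  ∈-thirds⁻ : ∀ {xs z} → Unique xs → z ∈ᴸ thirds xs →
              ∃₂ λ x y → x ∈ᴸ xs × y ∈ᴸ xs × x ≢ y × z ≡ x · y
  ∈-thirds⁻ {x ∷ xs} (x∉xs ∷ u) z∈ with ∈-++⁻ (map (x ·_) xs) z∈
  ... | inj₁ z∈x·xs = let y , y∈xs , z≡x·y = ∈-map⁻ (x ·_) z∈x·xs
                      in x , y , here refl , there y∈xs , All.lookup x∉xs y∈xs , z≡x·y
  ... | inj₂ z∈thirds = let x′ , y′ , x′∈ , y′∈ , x′≢y′ , z≡ = ∈-thirds⁻ u z∈thirds
                        in x′ , y′ , there x′∈ , there y′∈ , x′≢y′ , z≡

  -- 4-good lists and independent sets

  NoBlockIn : List (Fin v) → Set
  NoBlockIn ys = ∀ B → Block B → ¬ (B ⊆ˢᴸ ys)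

  -- The short windows at the end are constrained too, so that cons-good can start from [].
  FourGoodList : List (Fin v) → Set
  FourGoodList []       = ⊤
  FourGoodList (x ∷ xs) = NoBlockIn (take 4 (x ∷ xs)) × FourGoodList xs

  forbidden : List (Fin v) → List (Fin v)
  forbidden xs = thirds (take 3 xs)

  length-forbidden : ∀ xs → length (forbidden xs) ≤ 3
  length-forbidden []              = z≤n
  length-forbidden (_ ∷ [])        = z≤n
  length-forbidden (_ ∷ _ ∷ [])    = s≤s z≤n
  length-forbidden (_ ∷ _ ∷ _ ∷ _) = ≤-refl

  block-∃two-others : ∀ {B} → Block B → ∀ e → ∃₂ λ u w → u ∈ B × w ∈ B × u ≢ w × u ≢ e × w ≢ e
  block-∃two-others B-block e with block-∃∉ (e ∷ []) B-block (s≤s (s≤s z≤n))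
  ... | u , u∈B , u∉ with block-∃∉ (e ∷ u ∷ []) B-block ≤-refl
  ... | w , w∈B , w∉ =
    u , w , u∈B , w∈B , (λ u≡w → w∉ (there (here (sym u≡w)))) , u∉ ∘ here , w∉ ∘ here

  head-good : ∀ xs → FourGoodList xs → NoBlockIn (take 4 xs)
  head-good []       _             B B-block B⊆[] =
    contradiction (subst (_≤ 0) (block-size B B-block) (∣p∣≤length B [] B⊆[])) λ ()
  head-good (x ∷ xs) (no-block , _) = no-block

  cons-good : ∀ {e} xs → FourGoodList xs → e ∉ᴸ forbidden xs → FourGoodList (e ∷ xs)
  cons-good {e} xs good e∉ = no-block , good
    where
    no-block : NoBlockIn (e ∷ take 3 xs)
    no-block B B-block B⊆ with e ∈? B
    ... | no e∉B = head-good xs good B B-block λ x∈B →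
                     take-⊆ (n≤1+n 3) xs (∈-∷⁻ (B⊆ x∈B) λ { refl → e∉B x∈B })
    ... | yes e∈B =
      let u , w , u∈B , w∈B , u≢w , u≢e , w≢e = block-∃two-others B-block e
          e≡u·w = ·-unique B-block u∈B w∈B e∈B u≢w (≢-sym u≢e) (≢-sym w≢e)
      in e∉ (subst (_∈ᴸ forbidden xs) (sym e≡u·w)
                   (·∈thirds (∈-∷⁻ (B⊆ u∈B) u≢e) (∈-∷⁻ (B⊆ w∈B) w≢e) u≢w))

  Independent : List (Fin v) → Set
  Independent P = Disjoint (thirds P) P

  independent-∷ : ∀ {e} P → Independent P → e ∉ᴸ P → e ∉ᴸ thirds P → Independent (e ∷ P)
  independent-∷ {e} P indep e∉P e∉thirds {z} (z∈thirds , z∈e∷P)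
    with ∈-++⁻ (map (e ·_) P) z∈thirds
  ... | inj₂ z∈thirdsP = case z∈e∷P of λ
    { (here refl) → e∉thirds z∈thirdsP
    ; (there z∈P) → indep (z∈thirdsP , z∈P) }
  ... | inj₁ z∈e·P =
    let y , y∈P , z≡e·y = ∈-map⁻ (e ·_) z∈e·P
        _ , e·y≢e , e·y≢y = ·-third {e} {y} λ e≡y → e∉P (subst (_∈ᴸ P) (sym e≡y) y∈P)
    in case z∈e∷P of λ
      { (here z≡e) → e·y≢e (trans (sym z≡e·y) z≡e)
      ; (there z∈P) → e∉thirds (subst (_∈ᴸ thirds P) (sym (·-swap z≡e·y))
                                   (·∈thirds y∈P z∈P λ y≡z → e·y≢y (sym (trans y≡z z≡e·y)))) }

  independent-set : ∀ k → k C 2 < v → ∃ λ P → length P ≡ k × Unique P × Independent P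
  independent-set zero    _         = [] , refl , [] , λ { (() , _) }
  independent-set (suc k) [k+1]C2<v =
    let P , ∣P∣≡k , P-unique , P-indep = independent-set k kC2<v
        e , _ , e∉ = length<∣p∣⇒∃∈p∉ ⊤ˢ (P ++ thirds P) (∣P++thirdsP∣<v P ∣P∣≡k)
    in e ∷ P , cong suc ∣P∣≡k , ¬Any⇒All¬ P (e∉ ∘ ∈-++⁺ˡ) ∷ P-unique ,
       independent-∷ P P-indep (e∉ ∘ ∈-++⁺ˡ) (e∉ ∘ ∈-++⁺ʳ P)
    where
    kC2<v : k C 2 < v
    kC2<v = ≤-<-trans (≤-trans (m≤n+m (k C 2) k) (≤-reflexive (n+nC2≡[n+1]C2 k))) [k+1]C2<v
    ∣P++thirdsP∣<v : ∀ P → length P ≡ k → length (P ++ thirds P) < ∣ ⊤ˢ {v} ∣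
    ∣P++thirdsP∣<v P refl = begin-strict
      length (P ++ thirds P)         ≡⟨ length-++ P ⟩
      length P + length (thirds P)   ≡⟨ cong (length P +_) (length-thirds P) ⟩
      length P + length P C 2        ≡⟨ n+nC2≡[n+1]C2 (length P) ⟩
      suc (length P) C 2             <⟨ [k+1]C2<v ⟩
      v                              ≡⟨ ∣⊤∣≡n v ⟨
      ∣ ⊤ˢ {v} ∣                     ∎
      where open ≤-Reasoning

  independent⇒∉thirds : ∀ {P ys p} → Independent P → Unique ys → ys ⊆ᴸ P →
                        p ∈ᴸ P → p ∉ᴸ thirds ys
  independent⇒∉thirds indep ys-unique ys⊆P p∈P p∈thirds =
    let x , y , x∈ys , y∈ys , x≢y , p≡x·y = ∈-thirds⁻ ys-unique p∈thirds
    in indep (subst (_∈ᴸ _) (sym p≡x·y) (·∈thirds (ys⊆P x∈ys) (ys⊆P y∈ys) x≢y) , p∈P)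

  partners : Fin v → List (Fin v) → List (Fin v)
  partners z xs = map (_· z) (take 1 xs)

  length-partners : ∀ z xs → length (partners z xs) ≤ 1
  length-partners z []      = z≤n
  length-partners z (_ ∷ _) = ≤-refl

  ∈-map-·-swap : ∀ {p c z cs} → c ∈ᴸ cs → z ≡ p · c → p ∈ᴸ map (_· z) cs
  ∈-map-·-swap {z = z} c∈cs z≡p·c = subst (_∈ᴸ _) (sym (·-swap z≡p·c)) (∈-map⁺ (_· z) c∈cs)

  ∈-thirds-swap : ∀ {p₂ p₁ z} cs → z ∈ᴸ thirds (p₂ ∷ p₁ ∷ cs) →
                  p₂ ∈ᴸ p₁ · z ∷ map (_· z) cs ⊎ p₁ ∈ᴸ map (_· z) cs ⊎ z ∈ᴸ thirds cs
  ∈-thirds-swap {p₂} {p₁} cs z∈ with ∈-++⁻ (map (p₂ ·_) (p₁ ∷ cs)) z∈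
  ... | inj₁ (here z≡p₂·p₁) = inj₁ (here (·-swap z≡p₂·p₁))
  ... | inj₁ (there z∈p₂·cs) =
    let c , c∈cs , z≡p₂·c = ∈-map⁻ (p₂ ·_) z∈p₂·cs in inj₁ (there (∈-map-·-swap c∈cs z≡p₂·c))
  ... | inj₂ z∈thirds[p₁∷cs] with ∈-++⁻ (map (p₁ ·_) cs) z∈thirds[p₁∷cs]
  ... | inj₁ z∈p₁·cs =
    let c , c∈cs , z≡p₁·c = ∈-map⁻ (p₁ ·_) z∈p₁·cs in inj₂ (inj₁ (∈-map-·-swap c∈cs z≡p₁·c))
  ... | inj₂ z∈thirds-cs = inj₂ (inj₂ z∈thirds-cs)

  ∉-thirds-take1 : ∀ xs {z} → z ∉ᴸ thirds (take 1 xs)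
  ∉-thirds-take1 []      ()
  ∉-thirds-take1 (_ ∷ _) ()

  -- Since z = x · y iff y = x · z, the point z may be put in front of p₂ ∷ p₁ ∷ xs unless
  -- p₂ = p₁ · z, p₂ = c · z or p₁ = c · z, where c is the first point of xs.
  ∉-forbidden-after-two : ∀ {z p₁ p₂} xs → p₁ ∉ᴸ partners z xs → p₂ ∉ᴸ p₁ · z ∷ partners z xs →
                          z ∉ᴸ forbidden (p₂ ∷ p₁ ∷ xs)
  ∉-forbidden-after-two xs p₁∉ p₂∉ z∈ with ∈-thirds-swap (take 1 xs) z∈
  ... | inj₁ p₂∈             = p₂∉ p₂∈
  ... | inj₂ (inj₁ p₁∈)      = p₁∉ p₁∈
  ... | inj₂ (inj₂ z∈thirds) = ∉-thirds-take1 xs z∈thirds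

  length-forbidden-++<4+ : ∀ xs {ys k} → length ys ≤ k → length (forbidden xs ++ ys) < 4 + k
  length-forbidden-++<4+ xs {ys} ∣ys∣≤k =
    s≤s (≤-trans (≤-reflexive (length-++ (forbidden xs)))
                 (+-mono-≤ (length-forbidden xs) ∣ys∣≤k))

  module Completion (P₀ : List (Fin v)) (P₀-indep : Independent P₀) where

    -- Q and P are the points not yet placed, outside and inside P₀.
    record State : Set where
      field
        seq      : List (Fin v)
        Q P      : Subset v
        unique   : Unique seq
        good     : FourGoodList seq
        Q-fresh  : ∀ {x} → x ∈ Q → x ∉ᴸ seq
        P-fresh  : ∀ {x} → x ∈ P → x ∉ᴸ seq
        disjoint : ∀ {x} → x ∈ Q → x ∉ P
        P⊆P₀     : ∀ {x} → x ∈ P → x ∈ᴸ P₀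
        covers   : ∀ x → x ∈ᴸ seq ⊎ x ∈ Q ⊎ x ∈ P
    open State

    initial : State
    initial = record
      { seq = [] ; Q = ∁ (fromList P₀) ; P = fromList P₀
      ; unique = [] ; good = tt
      ; Q-fresh = λ _ () ; P-fresh = λ _ ()
      ; disjoint = x∈∁p⇒x∉p
      ; P⊆P₀ = ∈-fromList⁻ P₀
      ; covers = λ x → inj₂ (case x ∈? fromList P₀ of λ
          { (yes x∈P₀) → inj₂ x∈P₀ ; (no x∉P₀) → inj₁ (x∉p⇒x∈∁p x∉P₀) })
      }

    push : (st : State) {e : Fin v} → e ∈ Q st ⊎ e ∈ P st → e ∉ᴸ forbidden (seq st) → State
    push st {e} e∈ e∉ = record
      { seq = e ∷ seq st ; Q = Q st - e ; P = P st - e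
      ; unique = ¬Any⇒All¬ (seq st) e∉seq ∷ unique st
      ; good = cons-good (seq st) (good st) e∉
      ; Q-fresh = fresh (Q-fresh st) ; P-fresh = fresh (P-fresh st)
      ; disjoint = λ x∈Q x∈P → disjoint st (x∈p-y⇒x∈p x∈Q) (x∈p-y⇒x∈p x∈P)
      ; P⊆P₀ = P⊆P₀ st ∘ x∈p-y⇒x∈p
      ; covers = covers′
      }
      where
      e∉seq : e ∉ᴸ seq st
      e∉seq = [ Q-fresh st , P-fresh st ] e∈
      fresh : ∀ {p} → (∀ {x} → x ∈ p → x ∉ᴸ seq st) → ∀ {x} → x ∈ p - e → x ∉ᴸ e ∷ seq st
      fresh p-fresh x∈ (here x≡e)    = x∈p-y⇒x≢y x∈ x≡e
      fresh p-fresh x∈ (there x∈seq) = p-fresh (x∈p-y⇒x∈p x∈) x∈seq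
      covers′ : ∀ x → x ∈ᴸ e ∷ seq st ⊎ x ∈ Q st - e ⊎ x ∈ P st - e
      covers′ x with x ≟ e
      ... | yes x≡e = inj₁ (here x≡e)
      ... | no x≢e  =
        Sum.map there (Sum.map (λ x∈ → x∈p∧x≢y⇒x∈p-y x∈ x≢e) (λ x∈ → x∈p∧x≢y⇒x∈p-y x∈ x≢e)) (covers st x)

    reduceQ : ∀ n (st : State) → ∣ Q st ∣ ≤ n → Σ State λ st′ → ∣ Q st′ ∣ ≤ 3 × ∣ P st ∣ ≤ ∣ P st′ ∣
    reduceQ n st ∣Q∣≤n with ∣ Q st ∣ ≤? 3
    ... | yes ∣Q∣≤3 = st , ∣Q∣≤3 , ≤-refl
    reduceQ zero    st ∣Q∣≤0 | no ∣Q∣≰3 = contradiction (≤-trans ∣Q∣≤0 z≤n) ∣Q∣≰3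
    reduceQ (suc n) st ∣Q∣≤n | no ∣Q∣≰3 =
      let z , z∈Q , z∉ = length<∣p∣⇒∃∈p∉ (Q st) (forbidden (seq st))
                           (<-≤-trans (s≤s (length-forbidden (seq st))) (≰⇒> ∣Q∣≰3))
          st′ , ∣Q′∣≤3 , ∣P∣≤∣P′∣ = reduceQ n (push st (inj₁ z∈Q) z∉)
                                      (≤-pred (<-≤-trans (x∈p⇒∣p-x∣<∣p∣ z∈Q) ∣Q∣≤n))
      in st′ , ∣Q′∣≤3 , ≤-trans (x∉p⇒∣p∣≤∣p-x∣ (disjoint st z∈Q)) ∣P∣≤∣P′∣

    round : (st : State) {z : Fin v} → z ∈ Q st → 7 ≤ ∣ P st ∣ →
            Σ State λ st′ → ∣ Q st′ ∣ < ∣ Q st ∣ × ∣ P st ∣ ≤ 2 + ∣ P st′ ∣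
    round st {z} z∈Q 7≤∣P∣
      with length<∣p∣⇒∃∈p∉ (P st) (forbidden (seq st) ++ partners z (seq st))
             (≤-trans (length-forbidden-++<4+ (seq st) (length-partners z (seq st)))
                      (≤-trans (m≤n+m 5 2) 7≤∣P∣))
    ... | p₁ , p₁∈P , p₁∉
      with length<∣p∣⇒∃∈p∉ (P st - p₁) (forbidden (p₁ ∷ seq st) ++ p₁ · z ∷ partners z (seq st))
             (≤-trans (length-forbidden-++<4+ (p₁ ∷ seq st) (s≤s (length-partners z (seq st))))
                      (≤-pred (≤-trans 7≤∣P∣ (∣p∣≤1+∣p-x∣ (P st) p₁))))
    ... | p₂ , p₂∈P₁ , p₂∉ = st₃ , ∣Q₃∣<∣Q∣ , ∣P∣≤2+∣P₃∣
      where
      st₁ st₂ st₃ : State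
      st₁ = push st (inj₂ p₁∈P) (p₁∉ ∘ ∈-++⁺ˡ)
      st₂ = push st₁ (inj₂ p₂∈P₁) (p₂∉ ∘ ∈-++⁺ˡ)
      z≢ : ∀ {x} → x ∈ P st → z ≢ x
      z≢ x∈P refl = disjoint st z∈Q x∈P
      z∈Q₂ : z ∈ Q st₂
      z∈Q₂ = x∈p∧x≢y⇒x∈p-y (x∈p∧x≢y⇒x∈p-y z∈Q (z≢ p₁∈P)) (z≢ (x∈p-y⇒x∈p p₂∈P₁))
      z-allowed : z ∉ᴸ forbidden (seq st₂)
      z-allowed = ∉-forbidden-after-two (seq st) (p₁∉ ∘ ∈-++⁺ʳ (forbidden (seq st)))
                                                 (p₂∉ ∘ ∈-++⁺ʳ (forbidden (seq st₁)))
      st₃ = push st₂ (inj₁ z∈Q₂) z-allowed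
      ∣Q₃∣<∣Q∣ : ∣ Q st₃ ∣ < ∣ Q st ∣
      ∣Q₃∣<∣Q∣ = begin-strict
        ∣ Q st₃ ∣ <⟨ x∈p⇒∣p-x∣<∣p∣ z∈Q₂ ⟩
        ∣ Q st₂ ∣ ≤⟨ ∣p-x∣≤∣p∣ (Q st₁) p₂ ⟩
        ∣ Q st₁ ∣ ≤⟨ ∣p-x∣≤∣p∣ (Q st) p₁ ⟩
        ∣ Q st ∣  ∎
        where open ≤-Reasoning
      ∣P∣≤2+∣P₃∣ : ∣ P st ∣ ≤ 2 + ∣ P st₃ ∣
      ∣P∣≤2+∣P₃∣ = begin
        ∣ P st ∣       ≤⟨ ∣p∣≤1+∣p-x∣ (P st) p₁ ⟩
        1 + ∣ P st₁ ∣  ≤⟨ s≤s (∣p∣≤1+∣p-x∣ (P st₁) p₂) ⟩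
        2 + ∣ P st₂ ∣  ≤⟨ s≤s (s≤s (x∉p⇒∣p∣≤∣p-x∣ (disjoint st₂ z∈Q₂))) ⟩
        2 + ∣ P st₃ ∣  ∎
        where open ≤-Reasoning

    -- Each round uses two points of P; six of them must be left for exhaustP.
    exhaustQ : ∀ k (st : State) → ∣ Q st ∣ ≤ k → 2 * k + 6 ≤ ∣ P st ∣ →
               Σ State λ st′ → Empty (Q st′) × 6 ≤ ∣ P st′ ∣
    exhaustQ k st ∣Q∣≤k 2k+6≤∣P∣ with nonempty? (Q st)
    ... | no Q-empty = st , Q-empty , ≤-trans (m≤n+m 6 (2 * k)) 2k+6≤∣P∣
    exhaustQ zero    st ∣Q∣≤0 _ | yes (z , z∈Q) = contradiction z∈Q (∣p∣≤0⇒x∉p ∣Q∣≤0)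
    exhaustQ (suc k) st ∣Q∣≤k+1 2[k+1]+6≤∣P∣ | yes (z , z∈Q) =
      let st′ , ∣Q′∣<∣Q∣ , ∣P∣≤2+∣P′∣ =
            round st z∈Q (≤-trans (s≤s (s≤s (≤-trans (n≤1+n 5) (m≤n+m 6 (2 * k))))) 2+[2k+6]≤∣P∣)
      in exhaustQ k st′ (≤-pred (<-≤-trans ∣Q′∣<∣Q∣ ∣Q∣≤k+1))
                        (≤-pred (≤-pred (≤-trans 2+[2k+6]≤∣P∣ ∣P∣≤2+∣P′∣)))
      where
      2+[2k+6]≤∣P∣ : 2 + (2 * k + 6) ≤ ∣ P st ∣
      2+[2k+6]≤∣P∣ = subst (_≤ ∣ P st ∣) (cong (_+ 6) (*-suc 2 k)) 2[k+1]+6≤∣P∣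

    -- j points of P₀ lead the sequence; once j ≥ 3 every point of P is allowed by independence,
    -- and before that P still has at least four points.
    next-from-P : (st : State) (j : ℕ) → take j (seq st) ⊆ᴸ P₀ → 3 ≤ j ⊎ 6 ≤ j + ∣ P st ∣ →
                  ∀ {p} → p ∈ P st →
                  ∃ λ q → q ∈ P st × q ∉ᴸ forbidden (seq st) × (3 ≤ suc j ⊎ 6 ≤ suc j + ∣ P st - q ∣)
    next-from-P st j head⊆P₀ inv {p} p∈P with 3 ≤? j | inv
    ... | yes 3≤j | _ =
      p , p∈P ,
      independent⇒∉thirds P₀-indep (Unique.take⁺ 3 (unique st)) (head⊆P₀ ∘ take-⊆ 3≤j (seq st))
                                    (P⊆P₀ st p∈P) ,
      inj₁ (m≤n⇒m≤1+n 3≤j)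
    ... | no 3≰j | inj₁ 3≤j = contradiction 3≤j 3≰j
    ... | no 3≰j | inj₂ 6≤j+∣P∣ =
      let q , q∈P , q∉ = length<∣p∣⇒∃∈p∉ (P st) (forbidden (seq st))
                           (<-≤-trans (s≤s (length-forbidden (seq st))) 4≤∣P∣)
      in q , q∈P , q∉ ,
         inj₂ (≤-trans 6≤j+∣P∣ (≤-trans (+-monoʳ-≤ j (∣p∣≤1+∣p-x∣ (P st) q)) (≤-reflexive (+-suc j _))))
      where
      4≤∣P∣ : 4 ≤ ∣ P st ∣
      4≤∣P∣ = ≤-pred (≤-pred (≤-trans 6≤j+∣P∣ (+-monoˡ-≤ ∣ P st ∣ (≤-pred (≰⇒> 3≰j)))))

    exhaustP : ∀ n j (st : State) → ∣ P st ∣ ≤ n → Empty (Q st) → take j (seq st) ⊆ᴸ P₀ →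
               3 ≤ j ⊎ 6 ≤ j + ∣ P st ∣ → Σ State λ st′ → Empty (Q st′) × Empty (P st′)
    exhaustP n j st ∣P∣≤n Q-empty head⊆P₀ inv with nonempty? (P st)
    ... | no P-empty = st , Q-empty , P-empty
    exhaustP zero    j st ∣P∣≤0 _ _ _ | yes (p , p∈P) = contradiction p∈P (∣p∣≤0⇒x∉p ∣P∣≤0)
    exhaustP (suc n) j st ∣P∣≤n Q-empty head⊆P₀ inv | yes (p , p∈P) =
      let q , q∈P , q∉ , inv′ = next-from-P st j head⊆P₀ inv p∈P
      in exhaustP n (suc j) (push st (inj₂ q∈P) q∉) (≤-pred (<-≤-trans (x∈p⇒∣p-x∣<∣p∣ q∈P) ∣P∣≤n))
           (λ (x , x∈) → Q-empty (x , x∈p-y⇒x∈p x∈))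
           (λ { (here refl) → P⊆P₀ st q∈P ; (there x∈) → head⊆P₀ x∈ })
           inv′

    complete : (st : State) → Empty (Q st) → Empty (P st) → ∀ x → x ∈ᴸ seq st
    complete st Q-empty P-empty x with covers st x
    ... | inj₁ x∈seq      = x∈seq
    ... | inj₂ (inj₁ x∈Q) = ⊥-elim (Q-empty (x , x∈Q))
    ... | inj₂ (inj₂ x∈P) = ⊥-elim (P-empty (x , x∈P))

    good-enumeration : Unique P₀ → 12 ≤ length P₀ →
                       ∃ λ xs → Unique xs × FourGoodList xs × (∀ x → x ∈ᴸ xs)
    good-enumeration P₀-unique 12≤∣P₀∣ =
      let st₁ , ∣Q₁∣≤3 , ∣P₀∣≤∣P₁∣ = reduceQ v initial (∣p∣≤n (Q initial))
          st₂ , Q₂-empty , 6≤∣P₂∣ = exhaustQ 3 st₁ ∣Q₁∣≤3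
            (≤-trans 12≤∣P₀∣ (≤-trans (length≤∣p∣ _ P₀-unique (∈-fromList⁺ P₀)) ∣P₀∣≤∣P₁∣))
          st₃ , Q₃-empty , P₃-empty = exhaustP v 0 st₂ (∣p∣≤n (P st₂)) Q₂-empty (λ ()) (inj₂ 6≤∣P₂∣)
      in seq st₃ , unique st₃ , good st₃ , complete st₃ Q₃-empty P₃-empty

  -- fromℕ< takes its proof irrelevantly, so these proofs of i + k < m need not be those of FourGood.
  FourGoodList-window : ∀ xs → FourGoodList xs → ∀ {m} (e : m ≡ length xs) i (h : i + 3 < m) →
                        let at : ∀ j → j < m → Fin v
                            at j j<m = lookup xs (cast e (fromℕ< j<m))
                        in ∀ B → Block B → ¬ ContainedIn4 B
                             (at i       (≤-<-trans (m≤m+n i 3) h))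
                             (at (i + 1) (≤-<-trans (+-monoʳ-≤ i (s≤s z≤n)) h))
                             (at (i + 2) (≤-<-trans (+-monoʳ-≤ i (s≤s (s≤s z≤n))) h))
                             (at (i + 3) h)
  FourGoodList-window (w ∷ x ∷ y ∷ z ∷ _) (no-block , _) refl zero _ B B-block B⊆wxyz =
    no-block B B-block λ {u} u∈B → ∈-four (B⊆wxyz u u∈B)
  FourGoodList-window (_ ∷ _ ∷ [])      _ refl zero (s≤s (s≤s ()))
  FourGoodList-window (_ ∷ _ ∷ _ ∷ [])  _ refl zero (s≤s (s≤s (s≤s ())))
  FourGoodList-window (_ ∷ xs) (_ , good) refl (suc i) (s≤s h) =
    FourGoodList-window xs good refl i h

  enumeration↔ : ∀ xs → Unique xs → (∀ x → x ∈ᴸ xs) → Permutation (length xs) v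
  enumeration↔ xs xs-unique complete = permutation (lookup xs) (index ∘ complete)
    (λ x → sym (lookup-index (complete x)))
    (λ i → trans (cong index (∈-irrelevant (complete (lookup xs i)) (∈-lookup i)))
                 (index-∈-lookup xs i))
    where
    ∈-irrelevant : ∀ {x} (p q : x ∈ᴸ xs) → p ≡ q
    ∈-irrelevant =
      SetoidMembership.unique⇒irrelevant (setoid (Fin v)) (Decidable⇒UIP.≡-irrelevant _≟_) xs-unique

  enumeration⇒sequencing : ∀ xs → Unique xs → (∀ x → x ∈ᴸ xs) → FourGoodList xs →
                           Σ (Sequencing v) (FourGood S)
  enumeration⇒sequencing xs xs-unique complete good =
    cast-id v≡∣xs∣ ∘ₚ enumeration↔ xs xs-unique complete ,
    FourGoodList-window xs good v≡∣xs∣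
    where
    v≡∣xs∣ : v ≡ length xs
    v≡∣xs∣ = sym (↔⇒≡ (enumeration↔ xs xs-unique complete))

theorem5 : (v : ℕ) → v > 71 → (S : STS v) →
    Σ (Sequencing v) λ π → FourGood S π
theorem5 v 71<v S =
  let P₀ , ∣P₀∣≡12 , P₀-unique , P₀-indep = independent-set S 12 (≤-trans (m≤n+m 67 5) 71<v)
      xs , xs-unique , xs-good , xs-complete =
        Completion.good-enumeration S P₀ P₀-indep P₀-unique (≤-reflexive (sym ∣P₀∣≡12))
  in enumeration⇒sequencing S xs xs-unique xs-complete xs-good
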